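{- Suppose $(\mathsf P,\mathsf{Opens})$ is a semitopology and $p\in\mathsf P$ is regular and $O\in\mathsf{Topen}$ is topen. Then $$ O\between K(p) \quad\text{if and only if}\quad O\subseteq K(p). $$
   Context: A semitopology is a pair $(\mathsf P,\mathsf{Opens})$ with $\mathsf{Opens}\subseteq\mathcal P(\mathsf P)$ containing $\varnothing$ and $\mathsf P$ and closed under arbitrary unions. For sets $X,Y$ write $X\between Y$ when $X\cap Y\neq\varnothing$. A set $T$ is transitive when for all open $O,O'$, $O\between T\between O'$ implies $O\between O'$; $T$ is topen when nonempty, open and transitive; $\mathsf{Topen}$ is the set of topens. Points $p,p'$ are intertwined when every open neighbourhood of $p$ intersects every open neighbourhood of $p'$; $p_{\between}$ denotes the set of points intertwined with $p$. $\mathrm{interior}(X)$ is the union of open sets contained in $X$. The community of $p$ is $K(p)=\mathrm{interior}(p_{\between})$, and $p$ is regular when $p\in K(p)\in\mathsf{Topen}$. -}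

module Defs where

open import Level using (Level; suc; _⊔_)
open import Data.Product using (Σ; ∃; _×_; _,_)
open import Data.Empty using (⊥)
open import Data.Unit using (⊤)
open import Relation.Nullary using (¬_)

Subset : Set → Set₁
Subset P = P → Set

_∈_ : {P : Set} → P → Subset P → Set
x ∈ X = X x

_⊆_ : {P : Set} → Subset P → Subset P → Set
X ⊆ Y = ∀ x → x ∈ X → x ∈ Y

∅ : {P : Set} → Subset P
∅ _ = ⊥

Full : {P : Set} → Subset P
Full _ = ⊤

⋃ : {P I : Set} → (I → Subset P) → Subset P
⋃ {I = I} F x = Σ I λ i → x ∈ F i

_≐_ : {P : Set} → Subset P → Subset P → Set
X ≐ Y = (X ⊆ Y) × (Y ⊆ X)

_≬_ : {P : Set} → Subset P → Subset P → Set
X ≬ Y = ∃ λ x → (x ∈ X) × (x ∈ Y)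

-- A semitopology on P.  Opens ⊆ 𝒫(P) is presented as a family of subsets
-- indexed by a type of codes Ω (so that Opens is a set of subsets living in
-- Set, avoiding universe bumps): a subset is open iff it is ⟦ o ⟧ for some o.
record Semitopology (P : Set) : Set₁ where
  field
    Ω         : Set
    ⟦_⟧       : Ω → Subset P
    open-∅    : Σ Ω λ o → ⟦ o ⟧ ≐ ∅
    open-full : Σ Ω λ o → ⟦ o ⟧ ≐ Full
    open-⋃    : ∀ {I : Set} (F : I → Ω) → Σ Ω λ o → ⟦ o ⟧ ≐ ⋃ (λ i → ⟦ F i ⟧)

module _ {P : Set} (S : Semitopology P) where
  open Semitopology S

  IsOpen : Subset P → Set
  IsOpen X = Σ Ω λ o → ⟦ o ⟧ ≐ X

  Transitive : Subset P → Set
  Transitive T = ∀ (o o' : Ω) → ⟦ o ⟧ ≬ T → T ≬ ⟦ o' ⟧ → ⟦ o ⟧ ≬ ⟦ o' ⟧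

  Topen : Subset P → Set
  Topen T = (∃ λ x → x ∈ T) × IsOpen T × Transitive T

  Intertwined : P → P → Set
  Intertwined p p' = ∀ (o o' : Ω) → p ∈ ⟦ o ⟧ → p' ∈ ⟦ o' ⟧ → ⟦ o ⟧ ≬ ⟦ o' ⟧

  intertwinedWith : P → Subset P
  intertwinedWith p = Intertwined p

  interior : Subset P → Subset P
  interior X x = Σ Ω λ o → (⟦ o ⟧ ⊆ X) × (x ∈ ⟦ o ⟧)

  K : P → Subset P
  K p = interior (intertwinedWith p)

  Regular : P → Set
  Regular p = (p ∈ K p) × Topen (K p)

-- A topen O meeting K(p) glues onto K(p): an open set through p meets K(p), K(p) meets O,
-- and O meets any open set through a point of O, so two applications of transitivity make
-- every point of O intertwined with p.  Being open, O then lies in the interior of p_≬.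
module Submission where

open import Defs
open import Function.Bundles using (_⇔_; mk⇔)
open import Data.Product using (_,_)

module _ {P : Set} (S : Semitopology P) where
  open Semitopology S

  ≬-sym : {X Y : Subset P} → X ≬ Y → Y ≬ X
  ≬-sym (x , x∈X , x∈Y) = x , x∈Y , x∈X

  ≬-respˡ-⊆ : {X Y Z : Subset P} → X ⊆ Z → X ≬ Y → Z ≬ Y
  ≬-respˡ-⊆ X⊆Z (x , x∈X , x∈Y) = x , X⊆Z x x∈X , x∈Y

  open⊆interior : {X : Subset P} (o : Ω) → ⟦ o ⟧ ⊆ X → ⟦ o ⟧ ⊆ interior S X
  open⊆interior o o⊆X x x∈o = o , o⊆X , x∈o

  transitive-chain : {T T' : Subset P} → IsOpen S T → Transitive S T → Transitive S T' →
    T ≬ T' → ∀ (o o' : Ω) → ⟦ o ⟧ ≬ T → T' ≬ ⟦ o' ⟧ → ⟦ o ⟧ ≬ ⟦ o' ⟧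
  transitive-chain (t , t⊆T , T⊆t) trT trT' T≬T' o o' o≬T T'≬o' =
    trT o o' o≬T (≬-respˡ-⊆ t⊆T t≬o')
    where
    t≬o' : ⟦ t ⟧ ≬ ⟦ o' ⟧
    t≬o' = trT' t o' (≬-respˡ-⊆ T⊆t T≬T') T'≬o'

  ⊆intertwinedWith : {T T' : Subset P} {p : P} → p ∈ T →
    IsOpen S T → Transitive S T → Transitive S T' → T ≬ T' → T' ⊆ intertwinedWith S p
  ⊆intertwinedWith {p = p} p∈T openT trT trT' T≬T' x x∈T' o o' p∈o x∈o' =
    transitive-chain openT trT trT' T≬T' o o' (p , p∈o , p∈T) (x , x∈T' , x∈o')

  topen-≬-community⇒⊆ : {p : P} {O : Subset P} → Regular S p → Topen S O →
    O ≬ K S p → O ⊆ K S p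
  topen-≬-community⇒⊆ (p∈K , _ , openK , trK) (_ , (o , o⊆O , O⊆o) , trO) O≬K x x∈O =
    open⊆interior o o⊆intertwined x (O⊆o x x∈O)
    where
    o⊆intertwined : ⟦ o ⟧ ⊆ intertwinedWith S _
    o⊆intertwined y y∈o =
      ⊆intertwinedWith p∈K openK trK trO (≬-sym O≬K) y (o⊆O y y∈o)

proposition4p23 : {P : Set} (S : Semitopology P) (p : P) (O : Subset P) →
    Regular S p → Topen S O → (O ≬ K S p) ⇔ (O ⊆ K S p)
proposition4p23 S p O regular topenO@((x , x∈O) , _) =
  mk⇔ (topen-≬-community⇒⊆ S regular topenO) (λ O⊆K → x , x∈O , O⊆K x x∈O)
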